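{- Let $p\geq7$ be a prime with $p\equiv 3\pmod 4$, and write $m=p-1=2r$ (so $r\geq3$ is odd). Let $f(x)=(x+1)(x^r-1)/(x-1)\in\mathbb{F}_p[x]$. Then the subgroup $M=\mathbb{F}_p^*$ is an automatically non-standard $f$-subgroup: $f$ divides $(x^m-1)/\big((x-1)\phi_{p,m}(x)\big)$, and there is an $f$-sequence $s$ over $\mathbb{F}_p$ with least period $m$ such that $\mathbb{F}_p^*=\{s_0,\ldots,s_{m-1}\}$.
   Context: $\phi_{p,m}$ denotes the $m$th cyclotomic polynomial $\phi_m(x)\in\mathbb{Z}[x]$ (defined by $x^m-1=\prod_{d\mid m}\phi_d(x)$) reduced modulo $p$; its zeros are exactly the primitive $m$th roots of unity. A sequence $s=\{s_n\}_{n\in\mathbb{Z}}$ is an $f$-sequence, for monic $f(x)=x^k-c_{k-1}x^{k-1}-\cdots-c_0$, if $s_n=c_{k-1}s_{n-1}+\cdots+c_0s_{n-k}$ for all $n\in\mathbb{Z}$. For a field $\mathbb{F}$ of characteristic $p$ and $m>1$ with $(m,p)=1$, if $f\in\mathbb{F}[x]$ divides $(x^m-1)/((x-1)\phi_{p,m}(x))$ and $s$ is an $f$-sequence for which $M=\{s_0,\ldots,s_{m-1}\}$ is a subgroup of size $m$, then $M$ is called an automatically non-standard $f$-subgroup. -}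

module Defs where

open import Data.Nat as ℕ using (ℕ; zero; suc)
open import Data.Nat.Divisibility using (_∣?_)
open import Data.Integer as ℤ using (ℤ; +_; -_; _-_)
open import Data.Integer.Divisibility as ℤD using ()
open import Data.List using (List; []; _∷_; map; filter; foldr; upTo; replicate; _++_; length)
open import Data.Product using (Σ; _×_)
open import Relation.Nullary using (¬_)
open import Relation.Binary.PropositionalEquality using (_≡_)

-- Arithmetic of ℤ modulo p  (elements of 𝔽_p are represented by integers,
-- and equality in 𝔽_p is congruence modulo p)

_≡_[mod_] : ℤ → ℤ → ℕ → Set
a ≡ b [mod p ] = (+ p) ℤD.∣ (a - b)

sumℤ : List ℤ → ℤ
sumℤ = foldr ℤ._+_ (+ 0)

-- Polynomials: coefficient lists, lowest degree first

Poly : Set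
Poly = List ℤ

coeff : Poly → ℕ → ℤ
coeff []       _       = + 0
coeff (a ∷ f)  zero    = a
coeff (a ∷ f)  (suc i) = coeff f i

_+ₚ_ : Poly → Poly → Poly
[]      +ₚ g       = g
(a ∷ f) +ₚ []      = a ∷ f
(a ∷ f) +ₚ (b ∷ g) = (a ℤ.+ b) ∷ (f +ₚ g)

_*ₚ_ : Poly → Poly → Poly
[]      *ₚ g = []
(a ∷ f) *ₚ g = map (a ℤ.*_) g +ₚ (+ 0 ∷ (f *ₚ g))

prodₚ : List Poly → Poly
prodₚ = foldr _*ₚ_ (+ 1 ∷ [])

xPowMinusOne : ℕ → Poly
xPowMinusOne n = (- + 1 ∷ []) +ₚ (replicate n (+ 0) ++ (+ 1 ∷ []))

xMinusOne : Poly
xMinusOne = xPowMinusOne 1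

_≈ₚ_ : Poly → Poly → Set
f ≈ₚ g = ∀ i → coeff f i ≡ coeff g i

_≈ₚ_[mod_] : Poly → Poly → ℕ → Set
f ≈ₚ g [mod p ] = ∀ i → coeff f i ≡ coeff g i [mod p ]

divisors : ℕ → List ℕ
divisors n = filter (λ d → d ∣? n) (map suc (upTo n))

-- Φ is the family of cyclotomic polynomials: ∏_{d∣n} Φ d = x^n - 1 for all n ≥ 1
-- (this determines Φ n uniquely for every n ≥ 1)
IsCyclotomicFamily : (ℕ → Poly) → Set
IsCyclotomicFamily Φ = ∀ n → 1 ℕ.≤ n → prodₚ (map Φ (divisors n)) ≈ₚ xPowMinusOne n

-- f-sequences over 𝔽_p.
-- For monic f = x^k - c_{k-1}x^{k-1} - ⋯ - c_0 (so c_i = - coeff f i, k = deg f),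
-- s is an f-sequence iff s_n = c_{k-1} s_{n-1} + ⋯ + c_0 s_{n-k} for all n ∈ ℤ.

IsFSeq : ℕ → Poly → (ℤ → ℤ) → Set
IsFSeq p f s = ∀ (n : ℤ) →
  s n ≡ sumℤ (map (λ i → (- coeff f i) ℤ.* s ((n - + k) ℤ.+ + i)) (upTo k)) [mod p ]
  where k = length f ℕ.∸ 1

IsPeriod : ℕ → (ℤ → ℤ) → ℕ → Set
IsPeriod p s t = ∀ (n : ℤ) → s (n ℤ.+ + t) ≡ s n [mod p ]

IsLeastPeriod : ℕ → (ℤ → ℤ) → ℕ → Set
IsLeastPeriod p s m = 1 ℕ.≤ m × IsPeriod p s m × (∀ t → 1 ℕ.≤ t → t ℕ.< m → ¬ IsPeriod p s t)

ValuesAreUnits : ℕ → (ℤ → ℤ) → ℕ → Set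
ValuesAreUnits p s m =
  (∀ i → i ℕ.< m → ¬ (s (+ i) ≡ + 0 [mod p ])) ×
  (∀ (a : ℤ) → ¬ (a ≡ + 0 [mod p ]) → Σ ℕ λ i → i ℕ.< m × (s (+ i) ≡ a [mod p ]))

-- f(x) = (x+1)(x^r - 1)/(x - 1) = (x+1)(1 + x + ⋯ + x^{r-1})

fPoly : ℕ → Poly
fPoly r = (+ 1 ∷ + 1 ∷ []) *ₚ replicate r (+ 1)

-- From x^m - 1 = ∏_{d ∣ m} Φ_d and x^r - 1 = ∏_{d ∣ r} Φ_d,
-- x^m - 1 = (x^r - 1) · ∏_{d ∣ m, d ∤ r} Φ_d, and as r is odd the second product contains both Φ_2 = x + 1 and Φ_m.
-- Together with x^r - 1 = (x - 1)(1 + x + ⋯ + x^(r-1)) this exhibits f · (x - 1) · Φ_m as a divisor of x^m - 1.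
-- For the sequence take σ(t) = (2 (t mod r) + 1 - r) + (r + 1)(-1)^t. The sawtooth part sums to 0 over any r
-- consecutive terms, and since r is odd the alternating part sums to (r + 1)(-1)^t there, which x + 1 then kills:
-- f(E) annihilates σ already over ℤ. Modulo p, σ(t) is 2 (t mod r) + 2 for even t and 2 (t mod r) + 1 for odd t;
-- as r is odd, t ↦ (t mod r, t mod 2) is a bijection on [0, 2r), so over one period σ takes each of the values
-- 1, …, p - 1 exactly once.

module Submission where

open import Defs
open import Algebra.Bundles using (CommutativeMonoid)
open import Data.Integer as ℤ using (ℤ; +_; -[1+_]; 0ℤ; 1ℤ; -1ℤ; _+_; _*_; -_; _-_; _^_; _%ℕ_; _/ℕ_)
import Data.Integer.DivMod as ℤ
import Data.Integer.Divisibility.Signed as ℤˢ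
import Data.Integer.Properties as ℤ
open import Data.Integer.Tactic.RingSolver using (solve-∀)
open import Data.List using (List; []; _∷_; map; replicate; _++_; [_]; _∷ʳ_; filter; upTo; applyUpTo; length)
open import Data.List.Properties
  using (filter-accept; filter-reject; filter-++; map-++; map-replicate; map-applyUpTo; upTo-∷ʳ; ++-identityʳ; length-++)
open import Data.Nat as ℕ using (ℕ; zero; suc; NonZero; _<_; _≤_; s≤s; z≤n; _∸_; _/_; _%_)
open import Data.Nat.Divisibility using (_∣_; _∣?_; divides; 1∣_; ∣-refl; ∣-trans; ∣⇒≤; >⇒∤; _∣0)
open import Data.Nat.DivMod using ([m+n]%n≡m%n; m<n⇒m%n≡m; m%n<n; m≡m%n+[m/n]*n; m*n/n≡m)
open import Data.Nat.Primality using (Prime)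
import Data.Nat.Properties as ℕ
import Data.Nat.Tactic.RingSolver as ℕ-Ring
open import Data.Product using (Σ; _×_; _,_; map₂)
open import Data.Sum using (_⊎_; inj₁; inj₂)
open import Function using (_∘_)
open import Level using (Level)
open import Relation.Binary.Bundles using (Setoid)
open import Relation.Binary.PropositionalEquality
  using (_≡_; _≢_; refl; sym; trans; cong; cong₂; subst; module ≡-Reasoning)
import Relation.Binary.Reasoning.Setoid as SetoidReasoning
open import Relation.Nullary using (¬_; Dec; yes; no; contradiction)
open import Relation.Nullary.Decidable using (¬?)
open import Relation.Unary using (Pred; Decidable)

private
  variable
    ℓ ℓ′ ℓ″ : Level
    a b : ℤ
    f f′ g g′ h : Poly
    w v : ℕ → ℤ

-- Arithmetic in ℤ[x] up to coefficientwise equality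

-- _≈ₚ_ packed in a record, so that the compared polynomials can be inferred.
infix 4 _≋_
record _≋_ (f g : Poly) : Set where
  constructor coeffwise
  field coeff-≡ : f ≈ₚ g
open _≋_

≋-refl : f ≋ f
≋-refl = coeffwise λ i → refl

≋-sym : f ≋ g → g ≋ f
≋-sym (coeffwise f≈g) = coeffwise λ i → sym (f≈g i)

≋-trans : f ≋ g → g ≋ h → f ≋ h
≋-trans (coeffwise f≈g) (coeffwise g≈h) = coeffwise λ i → trans (f≈g i) (g≈h i)

≋-reflexive : f ≡ g → f ≋ g
≋-reflexive refl = ≋-refl

≋-setoid : Setoid _ _
≋-setoid = record
  { Carrier = Poly
  ; _≈_ = _≋_
  ; isEquivalence = record { refl = ≋-refl ; sym = ≋-sym ; trans = ≋-trans }
  }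

scale : ℤ → Poly → Poly
scale a = map (a *_)

coeff-+ₚ : ∀ f g i → coeff (f +ₚ g) i ≡ coeff f i + coeff g i
coeff-+ₚ []      g       i       = sym (ℤ.+-identityˡ _)
coeff-+ₚ (a ∷ f) []      i       = sym (ℤ.+-identityʳ _)
coeff-+ₚ (a ∷ f) (b ∷ g) zero    = refl
coeff-+ₚ (a ∷ f) (b ∷ g) (suc i) = coeff-+ₚ f g i

coeff-scale : ∀ a f i → coeff (scale a f) i ≡ a * coeff f i
coeff-scale a []      i       = sym (ℤ.*-zeroʳ a)
coeff-scale a (b ∷ f) zero    = refl
coeff-scale a (b ∷ f) (suc i) = coeff-scale a f i

∷-cong : a ≡ b → f ≋ g → a ∷ f ≋ b ∷ g
∷-cong a≡b (coeffwise f≈g) = coeffwise λ { zero → a≡b ; (suc i) → f≈g i }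

+ₚ-cong : f ≋ f′ → g ≋ g′ → (f +ₚ g) ≋ (f′ +ₚ g′)
+ₚ-cong {f} {f′} {g} {g′} (coeffwise f≈f′) (coeffwise g≈g′) = coeffwise λ i → begin
  coeff (f +ₚ g) i           ≡⟨ coeff-+ₚ f g i ⟩
  coeff f i + coeff g i      ≡⟨ cong₂ _+_ (f≈f′ i) (g≈g′ i) ⟩
  coeff f′ i + coeff g′ i    ≡⟨ coeff-+ₚ f′ g′ i ⟨
  coeff (f′ +ₚ g′) i         ∎
  where open ≡-Reasoning

scale-cong : ∀ a → f ≋ g → scale a f ≋ scale a g
scale-cong {f} {g} a (coeffwise f≈g) = coeffwise λ i → begin
  coeff (scale a f) i   ≡⟨ coeff-scale a f i ⟩
  a * coeff f i         ≡⟨ cong (a *_) (f≈g i) ⟩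
  a * coeff g i         ≡⟨ coeff-scale a g i ⟨
  coeff (scale a g) i   ∎
  where open ≡-Reasoning

+ₚ-interchange : ∀ f g h k → ((f +ₚ g) +ₚ (h +ₚ k)) ≋ ((f +ₚ h) +ₚ (g +ₚ k))
+ₚ-interchange f g h k = coeffwise λ i → begin
  coeff ((f +ₚ g) +ₚ (h +ₚ k)) i                        ≡⟨ coeff-+ₚ (f +ₚ g) (h +ₚ k) i ⟩
  coeff (f +ₚ g) i + coeff (h +ₚ k) i                   ≡⟨ cong₂ _+_ (coeff-+ₚ f g i) (coeff-+ₚ h k i) ⟩
  (coeff f i + coeff g i) + (coeff h i + coeff k i)     ≡⟨ interchange (coeff f i) (coeff g i) (coeff h i) (coeff k i) ⟩
  (coeff f i + coeff h i) + (coeff g i + coeff k i)     ≡⟨ cong₂ _+_ (coeff-+ₚ f h i) (coeff-+ₚ g k i) ⟨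
  coeff (f +ₚ h) i + coeff (g +ₚ k) i                   ≡⟨ coeff-+ₚ (f +ₚ h) (g +ₚ k) i ⟨
  coeff ((f +ₚ h) +ₚ (g +ₚ k)) i                        ∎
  where
  open ≡-Reasoning
  interchange : ∀ w x y z → (w + x) + (y + z) ≡ (w + y) + (x + z)
  interchange = solve-∀

scale-distribʳ : ∀ a b f → scale (a + b) f ≋ (scale a f +ₚ scale b f)
scale-distribʳ a b f = coeffwise λ i → begin
  coeff (scale (a + b) f) i                 ≡⟨ coeff-scale (a + b) f i ⟩
  (a + b) * coeff f i                       ≡⟨ ℤ.*-distribʳ-+ (coeff f i) a b ⟩
  a * coeff f i + b * coeff f i             ≡⟨ cong₂ _+_ (coeff-scale a f i) (coeff-scale b f i) ⟨
  coeff (scale a f) i + coeff (scale b f) i ≡⟨ coeff-+ₚ (scale a f) (scale b f) i ⟨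
  coeff (scale a f +ₚ scale b f) i         ∎
  where open ≡-Reasoning

+ₚ-identityʳ : ∀ f → (f +ₚ []) ≡ f
+ₚ-identityʳ []      = refl
+ₚ-identityʳ (a ∷ f) = refl

+ₚ-congˡ : ∀ h → f ≋ g → (h +ₚ f) ≋ (h +ₚ g)
+ₚ-congˡ h = +ₚ-cong (≋-refl {h})

+ₚ-congʳ : ∀ h → f ≋ g → (f +ₚ h) ≋ (g +ₚ h)
+ₚ-congʳ h f≋g = +ₚ-cong f≋g (≋-refl {h})

+ₚ-leftComm : ∀ f g h → (f +ₚ (g +ₚ h)) ≋ (g +ₚ (f +ₚ h))
+ₚ-leftComm f g h = coeffwise λ i → begin
  coeff (f +ₚ (g +ₚ h)) i                ≡⟨ coeff-+ₚ f (g +ₚ h) i ⟩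
  coeff f i + coeff (g +ₚ h) i           ≡⟨ cong (_+_ (coeff f i)) (coeff-+ₚ g h i) ⟩
  coeff f i + (coeff g i + coeff h i)    ≡⟨ leftComm (coeff f i) (coeff g i) (coeff h i) ⟩
  coeff g i + (coeff f i + coeff h i)    ≡⟨ cong (_+_ (coeff g i)) (coeff-+ₚ f h i) ⟨
  coeff g i + coeff (f +ₚ h) i           ≡⟨ coeff-+ₚ g (f +ₚ h) i ⟨
  coeff (g +ₚ (f +ₚ h)) i                ∎
  where
  open ≡-Reasoning
  leftComm : ∀ x y z → x + (y + z) ≡ y + (x + z)
  leftComm = solve-∀

scale-+ₚ : ∀ a f g → scale a (f +ₚ g) ≋ (scale a f +ₚ scale a g)
scale-+ₚ a f g = coeffwise λ i → begin
  coeff (scale a (f +ₚ g)) i                  ≡⟨ coeff-scale a (f +ₚ g) i ⟩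
  a * coeff (f +ₚ g) i                        ≡⟨ cong (a *_) (coeff-+ₚ f g i) ⟩
  a * (coeff f i + coeff g i)                 ≡⟨ ℤ.*-distribˡ-+ a (coeff f i) (coeff g i) ⟩
  a * coeff f i + a * coeff g i               ≡⟨ cong₂ _+_ (coeff-scale a f i) (coeff-scale a g i) ⟨
  coeff (scale a f) i + coeff (scale a g) i   ≡⟨ coeff-+ₚ (scale a f) (scale a g) i ⟨
  coeff (scale a f +ₚ scale a g) i            ∎
  where open ≡-Reasoning

scale-* : ∀ a b f → scale (a * b) f ≋ scale a (scale b f)
scale-* a b f = coeffwise λ i → begin
  coeff (scale (a * b) f) i      ≡⟨ coeff-scale (a * b) f i ⟩
  a * b * coeff f i              ≡⟨ ℤ.*-assoc a b (coeff f i) ⟩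
  a * (b * coeff f i)            ≡⟨ cong (a *_) (coeff-scale b f i) ⟨
  a * coeff (scale b f) i        ≡⟨ coeff-scale a (scale b f) i ⟨
  coeff (scale a (scale b f)) i  ∎
  where open ≡-Reasoning

scale-zero : ∀ f → scale 0ℤ f ≋ []
scale-zero f = coeffwise λ i → coeff-scale 0ℤ f i

*ₚ-congʳ : ∀ f → g ≋ g′ → (f *ₚ g) ≋ (f *ₚ g′)
*ₚ-congʳ []      g≋g′ = ≋-refl
*ₚ-congʳ (a ∷ f) g≋g′ = +ₚ-cong (scale-cong a g≋g′) (∷-cong refl (*ₚ-congʳ f g≋g′))

*ₚ-zeroʳ : ∀ f → (f *ₚ []) ≋ []
*ₚ-zeroʳ []      = ≋-refl
*ₚ-zeroʳ (a ∷ f) = coeffwise λ { zero → refl ; (suc i) → coeff-≡ (*ₚ-zeroʳ f) i }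

*ₚ-∷ : ∀ f b g → (f *ₚ (b ∷ g)) ≋ (scale b f +ₚ (0ℤ ∷ (f *ₚ g)))
*ₚ-∷ []      b g = coeffwise λ { zero → refl ; (suc i) → refl }
*ₚ-∷ (a ∷ f) b g = ∷-cong (cong (_+ 0ℤ) (ℤ.*-comm a b)) (begin
  scale a g +ₚ (f *ₚ (b ∷ g))                   ≈⟨ +ₚ-congˡ (scale a g) (*ₚ-∷ f b g) ⟩
  scale a g +ₚ (scale b f +ₚ (0ℤ ∷ (f *ₚ g)))   ≈⟨ +ₚ-leftComm (scale a g) (scale b f) _ ⟩
  scale b f +ₚ (scale a g +ₚ (0ℤ ∷ (f *ₚ g)))   ∎)
  where open SetoidReasoning ≋-setoid

*ₚ-comm : ∀ f g → (f *ₚ g) ≋ (g *ₚ f)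
*ₚ-comm []      g = ≋-sym (*ₚ-zeroʳ g)
*ₚ-comm (a ∷ f) g = ≋-trans (+ₚ-congˡ (scale a g) (∷-cong refl (*ₚ-comm f g))) (≋-sym (*ₚ-∷ g a f))

*ₚ-congˡ : ∀ h → f ≋ g → (f *ₚ h) ≋ (g *ₚ h)
*ₚ-congˡ {f} {g} h f≋g = ≋-trans (*ₚ-comm f h) (≋-trans (*ₚ-congʳ h f≋g) (*ₚ-comm h g))

*ₚ-cong : f ≋ f′ → g ≋ g′ → (f *ₚ g) ≋ (f′ *ₚ g′)
*ₚ-cong {f′ = f′} {g = g} f≋f′ g≋g′ = ≋-trans (*ₚ-congˡ g f≋f′) (*ₚ-congʳ f′ g≋g′)

*ₚ-distribʳ : ∀ f g h → ((f +ₚ g) *ₚ h) ≋ ((f *ₚ h) +ₚ (g *ₚ h))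
*ₚ-distribʳ []      g       h = ≋-refl
*ₚ-distribʳ (a ∷ f) []      h = ≋-reflexive (sym (+ₚ-identityʳ ((a ∷ f) *ₚ h)))
*ₚ-distribʳ (a ∷ f) (b ∷ g) h = begin
  scale (a + b) h +ₚ (0ℤ ∷ ((f +ₚ g) *ₚ h))
    ≈⟨ +ₚ-cong (scale-distribʳ a b h) (∷-cong refl (*ₚ-distribʳ f g h)) ⟩
  (scale a h +ₚ scale b h) +ₚ ((0ℤ ∷ (f *ₚ h)) +ₚ (0ℤ ∷ (g *ₚ h)))
    ≈⟨ +ₚ-interchange (scale a h) (scale b h) _ _ ⟩
  (scale a h +ₚ (0ℤ ∷ (f *ₚ h))) +ₚ (scale b h +ₚ (0ℤ ∷ (g *ₚ h)))  ∎
  where open SetoidReasoning ≋-setoid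

scale-*ₚ : ∀ a g h → (scale a g *ₚ h) ≋ scale a (g *ₚ h)
scale-*ₚ a []      h = ≋-refl
scale-*ₚ a (b ∷ g) h = begin
  scale (a * b) h +ₚ (0ℤ ∷ (scale a g *ₚ h))       ≈⟨ +ₚ-cong (scale-* a b h) (∷-cong (sym (ℤ.*-zeroʳ a)) (scale-*ₚ a g h)) ⟩
  scale a (scale b h) +ₚ scale a (0ℤ ∷ (g *ₚ h))   ≈⟨ scale-+ₚ a (scale b h) _ ⟨
  scale a (scale b h +ₚ (0ℤ ∷ (g *ₚ h)))           ∎
  where open SetoidReasoning ≋-setoid

*ₚ-assoc : ∀ f g h → ((f *ₚ g) *ₚ h) ≋ (f *ₚ (g *ₚ h))
*ₚ-assoc []      g h = ≋-refl
*ₚ-assoc (a ∷ f) g h = begin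
  (scale a g +ₚ (0ℤ ∷ (f *ₚ g))) *ₚ h                 ≈⟨ *ₚ-distribʳ (scale a g) _ h ⟩
  (scale a g *ₚ h) +ₚ ((0ℤ ∷ (f *ₚ g)) *ₚ h)          ≈⟨ +ₚ-cong (scale-*ₚ a g h) (+ₚ-congʳ _ (scale-zero h)) ⟩
  scale a (g *ₚ h) +ₚ (0ℤ ∷ ((f *ₚ g) *ₚ h))          ≈⟨ +ₚ-congˡ (scale a (g *ₚ h)) (∷-cong refl (*ₚ-assoc f g h)) ⟩
  scale a (g *ₚ h) +ₚ (0ℤ ∷ (f *ₚ (g *ₚ h)))          ∎
  where open SetoidReasoning ≋-setoid

*ₚ-identityˡ : ∀ f → ((1ℤ ∷ []) *ₚ f) ≋ f
*ₚ-identityˡ f = coeffwise λ i → begin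
  coeff (scale 1ℤ f +ₚ (0ℤ ∷ [])) i    ≡⟨ coeff-+ₚ (scale 1ℤ f) (0ℤ ∷ []) i ⟩
  coeff (scale 1ℤ f) i + coeff (0ℤ ∷ []) i  ≡⟨ cong₂ _+_ (coeff-scale 1ℤ f i) (coeff-[0] i) ⟩
  1ℤ * coeff f i + 0ℤ                 ≡⟨ ℤ.+-identityʳ _ ⟩
  1ℤ * coeff f i                      ≡⟨ ℤ.*-identityˡ _ ⟩
  coeff f i                           ∎
  where
  open ≡-Reasoning
  coeff-[0] : ∀ i → coeff (0ℤ ∷ []) i ≡ 0ℤ
  coeff-[0] zero    = refl
  coeff-[0] (suc i) = refl

*ₚ-identityʳ : ∀ f → (f *ₚ (1ℤ ∷ [])) ≋ f
*ₚ-identityʳ f = ≋-trans (*ₚ-comm f (1ℤ ∷ [])) (*ₚ-identityˡ f)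

*ₚ-commutativeMonoid : CommutativeMonoid _ _
*ₚ-commutativeMonoid = record
  { Carrier = Poly
  ; _≈_ = _≋_
  ; _∙_ = _*ₚ_
  ; ε = 1ℤ ∷ []
  ; isCommutativeMonoid = record
    { isMonoid = record
      { isSemigroup = record
        { isMagma = record { isEquivalence = Setoid.isEquivalence ≋-setoid ; ∙-cong = *ₚ-cong }
        ; assoc = *ₚ-assoc
        }
      ; identity = *ₚ-identityˡ , *ₚ-identityʳ
      }
    ; comm = *ₚ-comm
    }
  }

open import Algebra.Solver.CommutativeMonoid *ₚ-commutativeMonoid using (solve; _⊜_; _⊕_; id)

-- Products of cyclotomic polynomials

prodₚ-++ : ∀ fs gs → prodₚ (fs ++ gs) ≋ (prodₚ fs *ₚ prodₚ gs)
prodₚ-++ []       gs = ≋-sym (*ₚ-identityˡ (prodₚ gs))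
prodₚ-++ (f ∷ fs) gs = ≋-trans (*ₚ-congʳ f (prodₚ-++ fs gs)) (≋-sym (*ₚ-assoc f (prodₚ fs) (prodₚ gs)))

module _ {A : Set ℓ} {P : Pred A ℓ′} (P? : Decidable P) (Φ : A → Poly) where

  private
    ∏ : List A → Poly
    ∏ xs = prodₚ (map Φ xs)

  prodₚ-partition : ∀ xs → ∏ xs ≋ (∏ (filter P? xs) *ₚ ∏ (filter (¬? ∘ P?) xs))
  prodₚ-partition []       = ≋-sym (*ₚ-identityˡ (1ℤ ∷ []))
  prodₚ-partition (x ∷ xs) with P? x
  ... | yes _ = ≋-trans (*ₚ-congʳ (Φ x) (prodₚ-partition xs))
                  (solve 3 (λ a b c → (a ⊕ (b ⊕ c)) ⊜ ((a ⊕ b) ⊕ c)) ≋-refl (Φ x) (∏ (filter P? xs)) (∏ (filter (¬? ∘ P?) xs)))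
  ... | no _  = ≋-trans (*ₚ-congʳ (Φ x) (prodₚ-partition xs))
                  (solve 3 (λ a b c → (a ⊕ (b ⊕ c)) ⊜ (b ⊕ (a ⊕ c))) ≋-refl (Φ x) (∏ (filter P? xs)) (∏ (filter (¬? ∘ P?) xs)))

module _ {A : Set ℓ} {P : Pred A ℓ′} {Q : Pred A ℓ″} (P? : Decidable P) (Q? : Decidable Q)
         (P⇒Q : ∀ {x} → P x → Q x) where

  filter-filter-⊆ : ∀ xs → filter P? (filter Q? xs) ≡ filter P? xs
  filter-filter-⊆ []       = refl
  filter-filter-⊆ (x ∷ xs) = step (P? x)
    where
    open ≡-Reasoning
    step : Dec (P x) → filter P? (filter Q? (x ∷ xs)) ≡ filter P? (x ∷ xs)
    step (yes px) = begin
      filter P? (filter Q? (x ∷ xs))  ≡⟨ cong (filter P?) (filter-accept Q? (P⇒Q px)) ⟩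
      filter P? (x ∷ filter Q? xs)    ≡⟨ filter-accept P? px ⟩
      x ∷ filter P? (filter Q? xs)    ≡⟨ cong (x ∷_) (filter-filter-⊆ xs) ⟩
      x ∷ filter P? xs                ≡⟨ filter-accept P? px ⟨
      filter P? (x ∷ xs)              ∎
    step (no ¬px) = begin
      filter P? (filter Q? (x ∷ xs))  ≡⟨ drop-head (Q? x) ⟩
      filter P? (filter Q? xs)        ≡⟨ filter-filter-⊆ xs ⟩
      filter P? xs                    ≡⟨ filter-reject P? ¬px ⟨
      filter P? (x ∷ xs)              ∎
      where
      drop-head : Dec (Q x) → filter P? (filter Q? (x ∷ xs)) ≡ filter P? (filter Q? xs)
      drop-head (yes qx) = trans (cong (filter P?) (filter-accept Q? qx)) (filter-reject P? ¬px)
      drop-head (no ¬qx) = cong (filter P?) (filter-reject Q? ¬qx)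

filter-∣-interval : ∀ n t .{{_ : NonZero n}} →
  filter (_∣? n) (map suc (upTo (n ℕ.+ t))) ≡ filter (_∣? n) (map suc (upTo n))
filter-∣-interval n zero    = cong (λ l → filter (_∣? n) (map suc (upTo l))) (ℕ.+-identityʳ n)
filter-∣-interval n (suc t) = begin
  filter (_∣? n) (map suc (upTo (n ℕ.+ suc t)))                     ≡⟨ cong (λ l → filter (_∣? n) (map suc (upTo l))) (ℕ.+-suc n t) ⟩
  filter (_∣? n) (map suc (upTo (suc (n ℕ.+ t))))                   ≡⟨ cong (λ l → filter (_∣? n) (map suc l)) (upTo-∷ʳ (n ℕ.+ t)) ⟨
  filter (_∣? n) (map suc (upTo (n ℕ.+ t) ++ [ n ℕ.+ t ]))            ≡⟨ cong (filter (_∣? n)) (map-++ suc (upTo (n ℕ.+ t)) [ n ℕ.+ t ]) ⟩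
  filter (_∣? n) (map suc (upTo (n ℕ.+ t)) ++ [ suc (n ℕ.+ t) ])      ≡⟨ filter-++ (_∣? n) (map suc (upTo (n ℕ.+ t))) [ suc (n ℕ.+ t) ] ⟩
  filter (_∣? n) (map suc (upTo (n ℕ.+ t))) ++ filter (_∣? n) [ suc (n ℕ.+ t) ]
    ≡⟨ cong₂ _++_ (filter-∣-interval n t) (filter-reject (_∣? n) (>⇒∤ (s≤s (ℕ.m≤m+n n t)))) ⟩
  filter (_∣? n) (map suc (upTo n)) ++ []                        ≡⟨ ++-identityʳ _ ⟩
  filter (_∣? n) (map suc (upTo n))                               ∎
  where open ≡-Reasoning

divisors-∣ : ∀ {m n} .{{_ : NonZero m}} .{{_ : NonZero n}} → n ∣ m → filter (_∣? n) (divisors m) ≡ divisors n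
divisors-∣ {m} {n} n∣m with ℕ.m≤n⇒∃[o]m+o≡n (∣⇒≤ n∣m)
... | t , refl = trans (filter-filter-⊆ (_∣? n) (_∣? m) (λ d∣n → ∣-trans d∣n n∣m) (map suc (upTo m)))
                       (filter-∣-interval n t)

map-suc-upTo-ends : ∀ n → map suc (upTo (3 ℕ.+ n)) ≡ 1 ∷ 2 ∷ (map suc (applyUpTo (suc ∘ suc) n) ++ [ 3 ℕ.+ n ])
map-suc-upTo-ends n = trans (cong (map suc) (sym (upTo-∷ʳ (2 ℕ.+ n)))) (map-++ suc (upTo (2 ℕ.+ n)) [ 2 ℕ.+ n ])

xPowMinusOne-factor : ∀ n → (replicate n 1ℤ *ₚ xMinusOne) ≋ xPowMinusOne n
xPowMinusOne-factor zero    = coeffwise λ { zero → refl ; (suc i) → refl }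
xPowMinusOne-factor (suc n) = ∷-cong refl (≋-trans (+ₚ-congˡ (1ℤ ∷ []) (xPowMinusOne-factor n)) (one+xPowMinusOne n))
  where
  one+xPowMinusOne : ∀ n → ((1ℤ ∷ []) +ₚ xPowMinusOne n) ≋ (replicate n 0ℤ ++ [ 1ℤ ])
  one+xPowMinusOne zero    = ≋-refl
  one+xPowMinusOne (suc n) = ≋-refl

x+1*x-1 : ((1ℤ ∷ 1ℤ ∷ []) *ₚ xMinusOne) ≋ xPowMinusOne 2
x+1*x-1 = coeffwise λ { 0 → refl ; 1 → refl ; 2 → refl ; (suc (suc (suc i))) → refl }

module Cyclotomic (Φ : ℕ → Poly) (cyclotomic : IsCyclotomicFamily Φ) where

  ∏ : List ℕ → Poly
  ∏ ds = prodₚ (map Φ ds)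

  ∏-divisors : ∀ n .{{_ : NonZero n}} → ∏ (divisors n) ≋ xPowMinusOne n
  ∏-divisors (suc n) = coeffwise (cyclotomic (suc n) (s≤s z≤n))

  -- Without cancellation in ℤ[x] at hand, Φ₂ = x + 1 is only derived up to the factor x - 1.
  Φ₂*x-1 : (Φ 2 *ₚ xMinusOne) ≋ ((1ℤ ∷ 1ℤ ∷ []) *ₚ xMinusOne)
  Φ₂*x-1 = begin
    Φ 2 *ₚ xMinusOne                  ≈⟨ *ₚ-congʳ (Φ 2) (≋-trans (≋-sym (*ₚ-identityʳ (Φ 1))) (∏-divisors 1)) ⟨
    Φ 2 *ₚ Φ 1                        ≈⟨ solve 2 (λ a b → (b ⊕ a) ⊜ (a ⊕ (b ⊕ id))) ≋-refl (Φ 1) (Φ 2) ⟩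
    Φ 1 *ₚ (Φ 2 *ₚ (1ℤ ∷ []))         ≈⟨ ∏-divisors 2 ⟩
    xPowMinusOne 2                    ≈⟨ x+1*x-1 ⟨
    (1ℤ ∷ 1ℤ ∷ []) *ₚ xMinusOne       ∎
    where open SetoidReasoning ≋-setoid

  xPowMinusOne-∣ : ∀ {m n} .{{_ : NonZero m}} .{{_ : NonZero n}} → n ∣ m →
    xPowMinusOne m ≋ (xPowMinusOne n *ₚ ∏ (filter (¬? ∘ (_∣? n)) (divisors m)))
  xPowMinusOne-∣ {m} {n} n∣m = begin
    xPowMinusOne m                                                         ≈⟨ ∏-divisors m ⟨
    ∏ (divisors m)                                                         ≈⟨ prodₚ-partition (_∣? n) Φ (divisors m) ⟩
    ∏ (filter (_∣? n) (divisors m)) *ₚ ∏ (filter (¬? ∘ (_∣? n)) (divisors m))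
      ≈⟨ *ₚ-congˡ (∏ (filter (¬? ∘ (_∣? n)) (divisors m))) (≋-trans (≋-reflexive (cong ∏ (divisors-∣ n∣m))) (∏-divisors n)) ⟩
    xPowMinusOne n *ₚ ∏ (filter (¬? ∘ (_∣? n)) (divisors m))              ∎
    where open SetoidReasoning ≋-setoid

module _ (k : ℕ) (2∤r : ¬ 2 ∣ 3 ℕ.+ k) where

  private
    r m : ℕ
    r = 3 ℕ.+ k
    m = r ℕ.+ r

    middle : List ℕ
    middle = map suc (applyUpTo (suc ∘ suc) (k ℕ.+ r))

    ∤r? : Decidable (λ d → ¬ d ∣ r)
    ∤r? = ¬? ∘ (_∣? r)

    r∣m : r ∣ m
    r∣m = divides 2 (cong (r ℕ.+_) (sym (ℕ.+-identityʳ r)))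

    2∣m : 2 ∣ m
    2∣m = divides r (trans (cong (r ℕ.+_) (sym (ℕ.+-identityʳ r))) (ℕ.*-comm 2 r))

    m∤r : ¬ m ∣ r
    m∤r = >⇒∤ (ℕ.m<m+n r (s≤s z≤n))

  divisors-2r-∤r : filter ∤r? (divisors m) ≡ 2 ∷ (filter ∤r? (filter (_∣? m) middle) ++ [ m ])
  divisors-2r-∤r = begin
    filter ∤r? (filter (_∣? m) (map suc (upTo m)))
      ≡⟨ cong (λ l → filter ∤r? (filter (_∣? m) l)) (map-suc-upTo-ends (k ℕ.+ r)) ⟩
    filter ∤r? (filter (_∣? m) (1 ∷ 2 ∷ (middle ++ [ m ])))
      ≡⟨ cong (filter ∤r?) (trans (filter-accept (_∣? m) (1∣ m)) (cong (1 ∷_) (filter-accept (_∣? m) 2∣m))) ⟩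
    filter ∤r? (1 ∷ 2 ∷ filter (_∣? m) (middle ++ [ m ]))
      ≡⟨ trans (filter-reject ∤r? (λ 1∤r → 1∤r (1∣ r))) (filter-accept ∤r? 2∤r) ⟩
    2 ∷ filter ∤r? (filter (_∣? m) (middle ++ [ m ]))
      ≡⟨ cong (λ l → 2 ∷ filter ∤r? l) (trans (filter-++ (_∣? m) middle [ m ]) (cong (filter (_∣? m) middle ++_) (filter-accept (_∣? m) ∣-refl))) ⟩
    2 ∷ filter ∤r? (filter (_∣? m) middle ++ [ m ])
      ≡⟨ cong (2 ∷_) (trans (filter-++ ∤r? (filter (_∣? m) middle) [ m ]) (cong (filter ∤r? (filter (_∣? m) middle) ++_) (filter-accept ∤r? m∤r))) ⟩
    2 ∷ (filter ∤r? (filter (_∣? m) middle) ++ [ m ])  ∎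
    where open ≡-Reasoning

  fPoly-cofactor : (Φ : ℕ → Poly) → IsCyclotomicFamily Φ →
                   Σ Poly λ g → ((fPoly r *ₚ g) *ₚ (xMinusOne *ₚ Φ m)) ≋ xPowMinusOne m
  fPoly-cofactor Φ cyclotomic = ∏ G , (begin
    ((x+1 *ₚ R) *ₚ ∏ G) *ₚ (xMinusOne *ₚ Φ m)
      ≈⟨ solve 5 (λ a b c d e → ((a ⊕ b) ⊕ c) ⊕ (d ⊕ e) ⊜ ((a ⊕ d) ⊕ b) ⊕ (c ⊕ e)) ≋-refl x+1 R (∏ G) xMinusOne (Φ m) ⟩
    ((x+1 *ₚ xMinusOne) *ₚ R) *ₚ (∏ G *ₚ Φ m)
      ≈⟨ *ₚ-congˡ (∏ G *ₚ Φ m) (*ₚ-congˡ R Φ₂*x-1) ⟨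
    ((Φ 2 *ₚ xMinusOne) *ₚ R) *ₚ (∏ G *ₚ Φ m)
      ≈⟨ solve 5 (λ a b c d e → ((a ⊕ b) ⊕ c) ⊕ (d ⊕ e) ⊜ (c ⊕ b) ⊕ (a ⊕ (d ⊕ (e ⊕ id)))) ≋-refl (Φ 2) xMinusOne R (∏ G) (Φ m) ⟩
    (R *ₚ xMinusOne) *ₚ (Φ 2 *ₚ (∏ G *ₚ (Φ m *ₚ (1ℤ ∷ []))))
      ≈⟨ *ₚ-cong (xPowMinusOne-factor r) (*ₚ-congʳ (Φ 2) (≋-sym (≋-trans (≋-reflexive (cong prodₚ (map-++ Φ G [ m ]))) (prodₚ-++ (map Φ G) [ Φ m ])))) ⟩
    xPowMinusOne r *ₚ ∏ (2 ∷ (G ++ [ m ]))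
      ≡⟨ cong (λ ds → xPowMinusOne r *ₚ ∏ ds) divisors-2r-∤r ⟨
    xPowMinusOne r *ₚ ∏ (filter ∤r? (divisors m))
      ≈⟨ xPowMinusOne-∣ r∣m ⟨
    xPowMinusOne m  ∎)
    where
    open SetoidReasoning ≋-setoid
    open Cyclotomic Φ cyclotomic
    x+1 R : Poly
    x+1 = 1ℤ ∷ 1ℤ ∷ []
    R = replicate r 1ℤ
    G : List ℕ
    G = filter ∤r? (filter (_∣? m) middle)

-- Polynomials acting on integer sequences

-- act f w = Σᵢ fᵢ w(i), the value at 0 of f(E) w for the shift operator E.
act : Poly → (ℕ → ℤ) → ℤ
act []      w = 0ℤ
act (a ∷ f) w = a * w 0 + act f (w ∘ suc)

act-cong : ∀ f → (∀ i → w i ≡ v i) → act f w ≡ act f v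
act-cong []      w≡v = refl
act-cong (a ∷ f) w≡v = cong₂ (λ x y → a * x + y) (w≡v 0) (act-cong f (w≡v ∘ suc))

act-+ₚ : ∀ f g w → act (f +ₚ g) w ≡ act f w + act g w
act-+ₚ []      g       w = sym (ℤ.+-identityˡ _)
act-+ₚ (a ∷ f) []      w = sym (ℤ.+-identityʳ _)
act-+ₚ (a ∷ f) (b ∷ g) w = begin
  (a + b) * w 0 + act (f +ₚ g) (w ∘ suc)                        ≡⟨ cong (_+_ ((a + b) * w 0)) (act-+ₚ f g (w ∘ suc)) ⟩
  (a + b) * w 0 + (act f (w ∘ suc) + act g (w ∘ suc))           ≡⟨ distrib a b (w 0) (act f (w ∘ suc)) (act g (w ∘ suc)) ⟩
  (a * w 0 + act f (w ∘ suc)) + (b * w 0 + act g (w ∘ suc))     ∎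
  where
  open ≡-Reasoning
  distrib : ∀ a b x y z → (a + b) * x + (y + z) ≡ (a * x + y) + (b * x + z)
  distrib = solve-∀

act-scale : ∀ a f w → act (scale a f) w ≡ a * act f w
act-scale a []      w = sym (ℤ.*-zeroʳ a)
act-scale a (b ∷ f) w = begin
  a * b * w 0 + act (scale a f) (w ∘ suc)   ≡⟨ cong (_+_ (a * b * w 0)) (act-scale a f (w ∘ suc)) ⟩
  a * b * w 0 + a * act f (w ∘ suc)         ≡⟨ factor a b (w 0) (act f (w ∘ suc)) ⟩
  a * (b * w 0 + act f (w ∘ suc))           ∎
  where
  open ≡-Reasoning
  factor : ∀ a b x y → a * b * x + a * y ≡ a * (b * x + y)
  factor = solve-∀

act-*ₚ : ∀ f g w → act (f *ₚ g) w ≡ act f (λ i → act g (λ j → w (i ℕ.+ j)))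
act-*ₚ []      g w = refl
act-*ₚ (a ∷ f) g w = begin
  act (scale a g +ₚ (0ℤ ∷ (f *ₚ g))) w                        ≡⟨ act-+ₚ (scale a g) _ w ⟩
  act (scale a g) w + (0ℤ * w 0 + act (f *ₚ g) (w ∘ suc))     ≡⟨ cong₂ _+_ (act-scale a g w) (trans (ℤ.+-identityˡ _) (act-*ₚ f g (w ∘ suc))) ⟩
  a * act g w + act f (λ i → act g (λ j → w (suc (i ℕ.+ j)))) ∎
  where open ≡-Reasoning

act-∷ʳ : ∀ f a w → act (f ∷ʳ a) w ≡ act f w + a * w (length f)
act-∷ʳ []      a w = trans (ℤ.+-identityʳ (a * w 0)) (sym (ℤ.+-identityˡ (a * w 0)))
act-∷ʳ (b ∷ f) a w = trans (cong (_+_ (b * w 0)) (act-∷ʳ f a (w ∘ suc))) (sym (ℤ.+-assoc (b * w 0) _ _))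

sumℤ-upTo-suc : ∀ n (F : ℕ → ℤ) → sumℤ (map F (upTo (suc n))) ≡ F 0 + sumℤ (map (F ∘ suc) (upTo n))
sumℤ-upTo-suc n F = cong (λ xs → F 0 + sumℤ xs) (trans (map-applyUpTo suc F n) (sym (map-applyUpTo (λ i → i) (F ∘ suc) n)))

neg-act-∷ʳ : ∀ f a w → - act f w ≡ sumℤ (map (λ i → (- coeff (f ∷ʳ a) i) * w i) (upTo (length f)))
neg-act-∷ʳ []      a w = refl
neg-act-∷ʳ (b ∷ f) a w = begin
  - (b * w 0 + act f (w ∘ suc))          ≡⟨ ℤ.neg-distrib-+ (b * w 0) _ ⟩
  - (b * w 0) + - act f (w ∘ suc)        ≡⟨ cong₂ _+_ (ℤ.neg-distribˡ-* b (w 0)) (neg-act-∷ʳ f a (w ∘ suc)) ⟩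
  (- b) * w 0 + sumℤ (map (λ i → (- coeff (f ∷ʳ a) i) * w (suc i)) (upTo (length f)))
                                         ≡⟨ sumℤ-upTo-suc (length f) (λ i → (- coeff ((b ∷ f) ∷ʳ a) i) * w i) ⟨
  sumℤ (map (λ i → (- coeff ((b ∷ f) ∷ʳ a) i) * w i) (upTo (suc (length f))))  ∎
  where open ≡-Reasoning

act-+-seq : ∀ f w v → act f (λ i → w i + v i) ≡ act f w + act f v
act-+-seq []      w v = refl
act-+-seq (a ∷ f) w v = begin
  a * (w 0 + v 0) + act f (λ i → w (suc i) + v (suc i))   ≡⟨ cong (_+_ (a * (w 0 + v 0))) (act-+-seq f (w ∘ suc) (v ∘ suc)) ⟩
  a * (w 0 + v 0) + (act f (w ∘ suc) + act f (v ∘ suc))   ≡⟨ distrib a (w 0) (v 0) (act f (w ∘ suc)) (act f (v ∘ suc)) ⟩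
  (a * w 0 + act f (w ∘ suc)) + (a * v 0 + act f (v ∘ suc)) ∎
  where
  open ≡-Reasoning
  distrib : ∀ a x y u z → a * (x + y) + (u + z) ≡ (a * x + u) + (a * y + z)
  distrib = solve-∀

act-*-seq : ∀ f c w → act f (λ i → c * w i) ≡ c * act f w
act-*-seq []      c w = sym (ℤ.*-zeroʳ c)
act-*-seq (a ∷ f) c w = begin
  a * (c * w 0) + act f (λ i → c * w (suc i))   ≡⟨ cong (_+_ (a * (c * w 0))) (act-*-seq f c (w ∘ suc)) ⟩
  a * (c * w 0) + c * act f (w ∘ suc)           ≡⟨ factor a c (w 0) (act f (w ∘ suc)) ⟩
  c * (a * w 0 + act f (w ∘ suc))               ∎
  where
  open ≡-Reasoning
  factor : ∀ a c x y → a * (c * x) + c * y ≡ c * (a * x + y)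
  factor = solve-∀

act-replicate-cong : ∀ k a → (∀ i → i < k → w i ≡ v i) → act (replicate k a) w ≡ act (replicate k a) v
act-replicate-cong zero    a w≡v = refl
act-replicate-cong (suc k) a w≡v =
  cong₂ (λ x y → a * x + y) (w≡v 0 (s≤s z≤n)) (act-replicate-cong k a (λ i i<k → w≡v (suc i) (s≤s i<k)))

window-snoc : ∀ k w → act (replicate (suc k) 1ℤ) w ≡ act (replicate k 1ℤ) w + w k
window-snoc zero    w = trans (ℤ.+-identityʳ _) (trans (ℤ.*-identityˡ (w 0)) (sym (ℤ.+-identityˡ (w 0))))
window-snoc (suc k) w = trans (cong (_+_ (1ℤ * w 0)) (window-snoc k (w ∘ suc))) (sym (ℤ.+-assoc (1ℤ * w 0) _ _))

window-slide : ∀ k w → act (replicate k 1ℤ) (w ∘ suc) ≡ act (replicate k 1ℤ) w + w k - w 0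
window-slide k w = begin
  act R (w ∘ suc)                       ≡⟨ add-sub (w 0) (act R (w ∘ suc)) ⟩
  (1ℤ * w 0 + act R (w ∘ suc)) - w 0    ≡⟨ cong (_- w 0) (window-snoc k w) ⟩
  act R w + w k - w 0                   ∎
  where
  open ≡-Reasoning
  R : Poly
  R = replicate k 1ℤ
  add-sub : ∀ x a → a ≡ (1ℤ * x + a) - x
  add-sub = solve-∀

window-periodic : ∀ k w → (∀ t → w (t ℕ.+ k) ≡ w t) → ∀ t → act (replicate k 1ℤ) (λ i → w (t ℕ.+ i)) ≡ act (replicate k 1ℤ) w
window-periodic k w periodic zero    = refl
window-periodic k w periodic (suc t) = begin
  act R (λ i → w (suc t ℕ.+ i))                  ≡⟨ act-cong R (λ i → cong w (sym (ℕ.+-suc t i))) ⟩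
  act R (W ∘ suc)                                ≡⟨ window-slide k W ⟩
  act R W + W k - W 0                            ≡⟨ cong₂ (λ x y → act R W + x - w y) (periodic t) (ℕ.+-identityʳ t) ⟩
  act R W + w t - w t                            ≡⟨ add-sub (act R W) (w t) ⟩
  act R W                                        ≡⟨ window-periodic k w periodic t ⟩
  act R w                                        ∎
  where
  open ≡-Reasoning
  R : Poly
  R = replicate k 1ℤ
  W : ℕ → ℤ
  W i = w (t ℕ.+ i)
  add-sub : ∀ a x → a + x - x ≡ a
  add-sub = solve-∀

window-odd-numbers : ∀ k n → act (replicate k 1ℤ) (λ i → + 2 * + i + 1ℤ - + n) ≡ + k * + k - + k * + n
window-odd-numbers zero    n = refl
window-odd-numbers (suc k) n = begin
  act (replicate (suc k) 1ℤ) F                       ≡⟨ window-snoc k F ⟩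
  act (replicate k 1ℤ) F + F k                       ≡⟨ cong (_+ F k) (window-odd-numbers k n) ⟩
  + k * + k - + k * + n + (+ 2 * + k + 1ℤ - + n)     ≡⟨ square-step (+ k) (+ n) ⟩
  (1ℤ + + k) * (1ℤ + + k) - (1ℤ + + k) * + n         ∎
  where
  open ≡-Reasoning
  F : ℕ → ℤ
  F i = + 2 * + i + 1ℤ - + n
  square-step : ∀ k n → k * k - k * n + (+ 2 * k + 1ℤ - n) ≡ (1ℤ + k) * (1ℤ + k) - (1ℤ + k) * n
  square-step = solve-∀

module _ (M : ℕ) .{{_ : NonZero M}} {A : Set} (w : ℕ → A) (periodic : ∀ t → w (t ℕ.+ M) ≡ w t) where

  periodic-* : ∀ t q → w (t ℕ.+ q ℕ.* M) ≡ w t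
  periodic-* t zero    = cong w (ℕ.+-identityʳ t)
  periodic-* t (suc q) = begin
    w (t ℕ.+ (M ℕ.+ q ℕ.* M))   ≡⟨ cong w (ℕ.+-assoc t M (q ℕ.* M)) ⟨
    w (t ℕ.+ M ℕ.+ q ℕ.* M)     ≡⟨ periodic-* (t ℕ.+ M) q ⟩
    w (t ℕ.+ M)                 ≡⟨ periodic t ⟩
    w t                         ∎
    where open ≡-Reasoning

  periodic-congruent : ∀ a b k → + a ≡ + b + k * + M → w a ≡ w b
  periodic-congruent a b (+ q)    eq = trans (cong w a≡b+qM) (periodic-* b q)
    where
    a≡b+qM : a ≡ b ℕ.+ q ℕ.* M
    a≡b+qM = ℤ.+-injective (trans eq (sym (trans (ℤ.pos-+ b (q ℕ.* M)) (cong (_+_ (+ b)) (ℤ.pos-* q M)))))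
  periodic-congruent a b -[1+ q ] eq = sym (periodic-congruent b a (+ suc q) (begin
    + b                                      ≡⟨ add-sub (+ b) (+ suc q) (+ M) ⟩
    (+ b + - (+ suc q) * + M) + + suc q * + M ≡⟨ cong (_+ + suc q * + M) eq ⟨
    + a + + suc q * + M                      ∎))
    where
    open ≡-Reasoning
    add-sub : ∀ b q m → b ≡ (b + - q * m) + q * m
    add-sub = solve-∀

  extendℤ : ℤ → A
  extendℤ z = w (z %ℕ M)

  extendℤ-+ : ∀ z i → extendℤ (z + + i) ≡ w (z %ℕ M ℕ.+ i)
  extendℤ-+ z i = periodic-congruent _ _ (q - q′) (begin
    + ((z + + i) %ℕ M)                    ≡⟨ add-sub (+ ((z + + i) %ℕ M)) q′ (+ M) ⟩
    + ((z + + i) %ℕ M) + q′ * + M - q′ * + M   ≡⟨ cong (_- q′ * + M) (ℤ.a≡a%ℕn+[a/ℕn]*n (z + + i) M) ⟨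
    z + + i - q′ * + M                    ≡⟨ cong (λ x → x + + i - q′ * + M) (ℤ.a≡a%ℕn+[a/ℕn]*n z M) ⟩
    + (z %ℕ M) + q * + M + + i - q′ * + M ≡⟨ regroup (+ (z %ℕ M)) q q′ (+ i) (+ M) ⟩
    + (z %ℕ M) + + i + (q - q′) * + M     ≡⟨ cong (_+ (q - q′) * + M) (ℤ.pos-+ (z %ℕ M) i) ⟨
    + (z %ℕ M ℕ.+ i) + (q - q′) * + M     ∎)
    where
    open ≡-Reasoning
    q q′ : ℤ
    q  = z /ℕ M
    q′ = (z + + i) /ℕ M
    add-sub : ∀ a q m → a ≡ a + q * m - q * m
    add-sub = solve-∀
    regroup : ∀ a q q′ i m → a + q * m + i - q′ * m ≡ a + i + (q - q′) * m
    regroup = solve-∀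

  extendℤ-< : ∀ t → t < M → extendℤ (+ t) ≡ w t
  extendℤ-< t t<M = cong w (m<n⇒m%n≡m t<M)

module _ {p : ℕ} where

  ≡⇒≡-mod : ∀ {a b} → a ≡ b → a ≡ b [mod p ]
  ≡⇒≡-mod {a} refl = subst (λ x → p ∣ ℤ.∣ x ∣) (sym (ℤ.+-inverseʳ a)) (p ∣0)

  ≡-mod-sym : ∀ a b → a ≡ b [mod p ] → b ≡ a [mod p ]
  ≡-mod-sym a b a≡b = subst (p ∣_) (ℤ.∣i-j∣≡∣j-i∣ a b) a≡b

  ≡-mod-trans : ∀ a b c → a ≡ b [mod p ] → b ≡ c [mod p ] → a ≡ c [mod p ]
  ≡-mod-trans a b c a≡b b≡c = ℤˢ.∣⇒∣ᵤ {+ p} (subst (+ p ℤˢ.∣_) (telescope a b c)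
    (ℤˢ.∣m∣n⇒∣m+n (ℤˢ.∣ᵤ⇒∣ {+ p} {a - b} a≡b) (ℤˢ.∣ᵤ⇒∣ {+ p} {b - c} b≡c)))
    where
    telescope : ∀ a b c → (a - b) + (b - c) ≡ a - c
    telescope = solve-∀

  ≡-mod-intro : ∀ a b k → a ≡ b + k * + p → a ≡ b [mod p ]
  ≡-mod-intro a b k eq = ℤˢ.∣⇒∣ᵤ {+ p} {a - b} (ℤˢ.divides k (begin
    a - b               ≡⟨ cong (_- b) eq ⟩
    b + k * + p - b     ≡⟨ add-sub b (k * + p) ⟩
    k * + p             ∎))
    where
    open ≡-Reasoning
    add-sub : ∀ b x → b + x - b ≡ x
    add-sub = solve-∀

  private
    ≡-mod-injective-≤ : ∀ {a b} → a < p → b ≤ a → (+ a) ≡ + b [mod p ] → a ≡ b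
    ≡-mod-injective-≤ {a} {b} a<p b≤a a≡b = ℕ.≤-antisym (ℕ.m∸n≡0⇒m≤n (small-multiple-is-0 p∣a∸b a∸b<p)) b≤a
      where
      p∣a∸b : p ∣ a ℕ.∸ b
      p∣a∸b = subst (p ∣_) (trans (cong ℤ.∣_∣ (ℤ.m-n≡m⊖n a b)) (trans (ℤ.∣m⊖n∣≡∣n⊖m∣ a b) (ℤ.∣⊖∣-≤ b≤a))) a≡b
      a∸b<p : a ℕ.∸ b < p
      a∸b<p = ℕ.≤-<-trans (ℕ.m∸n≤m a b) a<p
      small-multiple-is-0 : ∀ {n} → p ∣ n → n < p → n ≡ 0
      small-multiple-is-0 {zero}  _   _   = refl
      small-multiple-is-0 {suc n} p∣n n<p = contradiction p∣n (>⇒∤ n<p)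

  ≡-mod-injective : ∀ {a b} → a < p → b < p → (+ a) ≡ + b [mod p ] → a ≡ b
  ≡-mod-injective {a} {b} a<p b<p a≡b with ℕ.≤-total b a
  ... | inj₁ b≤a = ≡-mod-injective-≤ a<p b≤a a≡b
  ... | inj₂ a≤b = sym (≡-mod-injective-≤ b<p a≤b (≡-mod-sym (+ a) (+ b) a≡b))

  ≡-mod-nonzero : ∀ a {v} → suc v < p → a ≡ + suc v [mod p ] → ¬ (a ≡ 0ℤ [mod p ])
  ≡-mod-nonzero a {v} v<p a≡v a≡0 = contradiction
    (≡-mod-injective v<p (ℕ.<-trans (s≤s z≤n) v<p) (≡-mod-trans (+ suc v) a 0ℤ (≡-mod-sym a (+ suc v) a≡v) a≡0))
    λ ()

annihilated⇒IsFSeq : ∀ p {f} g s → f ≡ g ∷ʳ 1ℤ → (∀ z → act f (λ i → s (z + + i)) ≡ 0ℤ) → IsFSeq p f s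
annihilated⇒IsFSeq p g s refl annihilated =
  unfold k (trans (cong (_∸ 1) (length-++ g)) (ℕ.m+n∸n≡m k 1)) λ n → ≡⇒≡-mod (recurrence n)
  where
  k : ℕ
  k = length g
  -- IsFSeq names the order length f ∸ 1 locally; matching on refl identifies it with k.
  unfold : ∀ k → length (g ∷ʳ 1ℤ) ∸ 1 ≡ k →
           (∀ n → s n ≡ sumℤ (map (λ i → (- coeff (g ∷ʳ 1ℤ) i) * s ((n - + k) + + i)) (upTo k)) [mod p ]) →
           IsFSeq p (g ∷ʳ 1ℤ) s
  unfold _ refl recurrence = recurrence
  recurrence : ∀ n → s n ≡ sumℤ (map (λ i → (- coeff (g ∷ʳ 1ℤ) i) * s ((n - + k) + + i)) (upTo k))
  recurrence n = begin
    s n                                    ≡⟨ cong s (sub-add n (+ k)) ⟩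
    W k                                    ≡⟨ add-sub (act g W) (W k) ⟩
    (act g W + 1ℤ * W k) - act g W         ≡⟨ cong (_- act g W) (trans (sym (act-∷ʳ g 1ℤ W)) (annihilated (n - + k))) ⟩
    0ℤ - act g W                           ≡⟨ ℤ.+-identityˡ (- act g W) ⟩
    - act g W                              ≡⟨ neg-act-∷ʳ g 1ℤ W ⟩
    sumℤ (map (λ i → (- coeff (g ∷ʳ 1ℤ) i) * W i) (upTo k)) ∎
    where
    open ≡-Reasoning
    W : ℕ → ℤ
    W i = s ((n - + k) + + i)
    sub-add : ∀ n k → n ≡ (n - k) + k
    sub-add = solve-∀
    add-sub : ∀ x y → y ≡ (x + 1ℤ * y) - x
    add-sub = solve-∀

-- The sequence

alt : ℕ → ℤ
alt t = -1ℤ ^ t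

alt-+ : ∀ m n → alt (m ℕ.+ n) ≡ alt m * alt n
alt-+ = ℤ.^-distribˡ-+-* -1ℤ

alt-cases : ∀ t → alt t ≡ 1ℤ ⊎ alt t ≡ -1ℤ
alt-cases zero    = inj₁ refl
alt-cases (suc t) with alt-cases t
... | inj₁ eq = inj₂ (cong (-1ℤ *_) eq)
... | inj₂ eq = inj₁ (cong (-1ℤ *_) eq)

alt-double : ∀ t → alt (t ℕ.+ t) ≡ 1ℤ
alt-double t with alt-cases t
... | inj₁ eq = trans (alt-+ t t) (cong₂ _*_ eq eq)
... | inj₂ eq = trans (alt-+ t t) (cong₂ _*_ eq eq)

alt-odd⇒∤2 : ∀ {n} → alt n ≡ -1ℤ → ¬ 2 ∣ n
alt-odd⇒∤2 {n} odd (divides q n≡q*2) = 1≢-1 (begin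
  1ℤ              ≡⟨ alt-double q ⟨
  alt (q ℕ.+ q)   ≡⟨ cong alt (trans (cong (q ℕ.+_) (sym (ℕ.+-identityʳ q))) (ℕ.*-comm 2 q)) ⟩
  alt (q ℕ.* 2)   ≡⟨ cong alt n≡q*2 ⟨
  alt n           ≡⟨ odd ⟩
  -1ℤ             ∎)
  where
  open ≡-Reasoning
  1≢-1 : 1ℤ ≢ -1ℤ
  1≢-1 ()

fPoly-monic : ∀ n → fPoly (suc n) ≡ (1ℤ ∷ replicate n (+ 2)) ∷ʳ 1ℤ
fPoly-monic n = begin
  scale 1ℤ R +ₚ (0ℤ ∷ (scale 1ℤ R +ₚ (0ℤ ∷ [])))  ≡⟨ cong (λ S → S +ₚ (0ℤ ∷ (S +ₚ (0ℤ ∷ [])))) (map-replicate (1ℤ *_) (suc n) 1ℤ) ⟩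
  R +ₚ (0ℤ ∷ (R +ₚ (0ℤ ∷ [])))                   ≡⟨ cong (λ S → R +ₚ (0ℤ ∷ 1ℤ ∷ S)) (+ₚ-identityʳ (replicate n 1ℤ)) ⟩
  1ℤ ∷ (replicate n 1ℤ +ₚ (1ℤ ∷ replicate n 1ℤ))   ≡⟨ cong (1ℤ ∷_) (ones+shifted-ones n) ⟩
  1ℤ ∷ (replicate n (+ 2) ++ [ 1ℤ ])             ∎
  where
  open ≡-Reasoning
  R : Poly
  R = replicate (suc n) 1ℤ
  ones+shifted-ones : ∀ n → (replicate n 1ℤ +ₚ (1ℤ ∷ replicate n 1ℤ)) ≡ (replicate n (+ 2) ++ [ 1ℤ ])
  ones+shifted-ones zero    = refl
  ones+shifted-ones (suc n) = cong (+ 2 ∷_) (ones+shifted-ones n)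

even-or-odd : ∀ n → Σ ℕ λ j → n ≡ 2 ℕ.* j ⊎ n ≡ 1 ℕ.+ 2 ℕ.* j
even-or-odd zero = 0 , inj₁ refl
even-or-odd (suc n) with even-or-odd n
... | j , inj₁ n≡2j   = j , inj₂ (cong suc n≡2j)
... | j , inj₂ n≡1+2j = suc j , inj₁ (trans (cong suc n≡1+2j) (double-suc j))
  where
  double-suc : ∀ j → 2 ℕ.+ 2 ℕ.* j ≡ 2 ℕ.* suc j
  double-suc = ℕ-Ring.solve-∀

module Construction (r₀ : ℕ) (r-odd : alt (suc r₀) ≡ -1ℤ) where

  r M p : ℕ
  r = suc r₀
  M = r ℕ.+ r
  p = suc M

  saw : ℕ → ℤ
  saw t = + 2 * + (t % r) + 1ℤ - + r

  σ : ℕ → ℤ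
  σ t = saw t + + suc r * alt t

  R : Poly
  R = replicate r 1ℤ

  saw-periodic : ∀ t → saw (t ℕ.+ r) ≡ saw t
  saw-periodic t = cong (λ j → + 2 * + j + 1ℤ - + r) ([m+n]%n≡m%n t r)

  alt-+r : ∀ t → alt (t ℕ.+ r) ≡ - alt t
  alt-+r t = begin
    alt (t ℕ.+ r)    ≡⟨ alt-+ t r ⟩
    alt t * alt r    ≡⟨ cong (alt t *_) r-odd ⟩
    alt t * -1ℤ      ≡⟨ ℤ.*-comm (alt t) -1ℤ ⟩
    -1ℤ * alt t      ≡⟨ ℤ.-1*i≡-i (alt t) ⟩
    - alt t          ∎
    where open ≡-Reasoning

  σ-periodic : ∀ t → σ (t ℕ.+ M) ≡ σ t
  σ-periodic t = begin
    σ (t ℕ.+ (r ℕ.+ r))   ≡⟨ cong σ (ℕ.+-assoc t r r) ⟨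
    σ (t ℕ.+ r ℕ.+ r)     ≡⟨ cong₂ (λ x y → x + + suc r * y)
                               (trans (saw-periodic (t ℕ.+ r)) (saw-periodic t))
                               (trans (alt-+r (t ℕ.+ r)) (trans (cong -_ (alt-+r t)) (ℤ.neg-involutive (alt t)))) ⟩
    σ t                   ∎
    where open ≡-Reasoning

  saw-window : ∀ t → act R (λ i → saw (t ℕ.+ i)) ≡ 0ℤ
  saw-window t = begin
    act R (λ i → saw (t ℕ.+ i))            ≡⟨ window-periodic r saw saw-periodic t ⟩
    act R saw                              ≡⟨ act-replicate-cong r 1ℤ (λ i i<r → cong (λ j → + 2 * + j + 1ℤ - + r) (m<n⇒m%n≡m i<r)) ⟩
    act R (λ i → + 2 * + i + 1ℤ - + r)     ≡⟨ window-odd-numbers r r ⟩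
    + r * + r - + r * + r                  ≡⟨ ℤ.+-inverseʳ (+ r * + r) ⟩
    0ℤ                                     ∎
    where open ≡-Reasoning

  -- Shifting the window by one negates it, and by oddness of r it also subtracts 2·alt t.
  alt-window : ∀ t → act R (λ i → alt (t ℕ.+ i)) ≡ alt t
  alt-window t = ℤ.*-cancelˡ-≡ (+ 2) A (alt t) (begin
    + 2 * A                                        ≡⟨ double A (alt t) ⟩
    (A + - alt t - alt t) - -1ℤ * A + + 2 * alt t  ≡⟨ cong (λ x → x - -1ℤ * A + + 2 * alt t) slid ⟨
    -1ℤ * A - -1ℤ * A + + 2 * alt t                ≡⟨ cancel (-1ℤ * A) (+ 2 * alt t) ⟩
    + 2 * alt t                                    ∎)
    where
    open ≡-Reasoning
    W : ℕ → ℤ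
    W i = alt (t ℕ.+ i)
    A : ℤ
    A = act R W
    slid : -1ℤ * A ≡ A + - alt t - alt t
    slid = begin
      -1ℤ * A                             ≡⟨ act-*-seq R -1ℤ W ⟨
      act R (λ i → alt (suc (t ℕ.+ i)))   ≡⟨ act-cong R (λ i → cong alt (ℕ.+-suc t i)) ⟨
      act R (λ i → W (suc i))             ≡⟨ window-slide r W ⟩
      A + W r - W 0                       ≡⟨ cong₂ (λ x y → A + x - alt y) (alt-+r t) (ℕ.+-identityʳ t) ⟩
      A + - alt t - alt t                 ∎
    double : ∀ a s → + 2 * a ≡ (a + - s - s) - -1ℤ * a + + 2 * s
    double = solve-∀
    cancel : ∀ x y → x - x + y ≡ y
    cancel = solve-∀

  σ-window : ∀ t → act R (λ i → σ (t ℕ.+ i)) ≡ + suc r * alt t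
  σ-window t = begin
    act R (λ i → σ (t ℕ.+ i))                                             ≡⟨ act-+-seq R (λ i → saw (t ℕ.+ i)) (λ i → + suc r * alt (t ℕ.+ i)) ⟩
    act R (λ i → saw (t ℕ.+ i)) + act R (λ i → + suc r * alt (t ℕ.+ i))  ≡⟨ cong₂ _+_ (saw-window t) (act-*-seq R (+ suc r) (λ i → alt (t ℕ.+ i))) ⟩
    0ℤ + + suc r * act R (λ i → alt (t ℕ.+ i))                           ≡⟨ ℤ.+-identityˡ (+ suc r * act R (λ i → alt (t ℕ.+ i))) ⟩
    + suc r * act R (λ i → alt (t ℕ.+ i))                                ≡⟨ cong (+ suc r *_) (alt-window t) ⟩
    + suc r * alt t                                                       ∎
    where open ≡-Reasoning

  σ-annihilated : ∀ t → act (fPoly r) (λ i → σ (t ℕ.+ i)) ≡ 0ℤ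
  σ-annihilated t = begin
    act ((1ℤ ∷ 1ℤ ∷ []) *ₚ R) (λ i → σ (t ℕ.+ i))
      ≡⟨ act-*ₚ (1ℤ ∷ 1ℤ ∷ []) R (λ i → σ (t ℕ.+ i)) ⟩
    1ℤ * act R (λ j → σ (t ℕ.+ j)) + (1ℤ * act R (λ j → σ (t ℕ.+ suc j)) + 0ℤ)
      ≡⟨ cong₂ (λ x y → 1ℤ * x + (1ℤ * y + 0ℤ)) (σ-window t) (trans (act-cong R (λ j → cong σ (ℕ.+-suc t j))) (σ-window (suc t))) ⟩
    1ℤ * (+ suc r * alt t) + (1ℤ * (+ suc r * (-1ℤ * alt t)) + 0ℤ)
      ≡⟨ cancels (+ suc r) (alt t) ⟩
    0ℤ  ∎
    where
    open ≡-Reasoning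
    cancels : ∀ c a → 1ℤ * (c * a) + (1ℤ * (c * (-1ℤ * a)) + 0ℤ) ≡ 0ℤ
    cancels = solve-∀

  s : ℤ → ℤ
  s = extendℤ M σ σ-periodic

  s-annihilated : ∀ z → act (fPoly r) (λ i → s (z + + i)) ≡ 0ℤ
  s-annihilated z = trans (act-cong (fPoly r) (extendℤ-+ M σ σ-periodic z)) (σ-annihilated (z %ℕ M))

  s-isFSeq : IsFSeq p (fPoly r) s
  s-isFSeq = annihilated⇒IsFSeq p (1ℤ ∷ replicate r₀ (+ 2)) s (fPoly-monic r₀) s-annihilated

  s-periodic : IsPeriod p s M
  s-periodic n = ≡⇒≡-mod (trans (extendℤ-+ M σ σ-periodic n M) (σ-periodic (n %ℕ M)))

  s-< : ∀ t → t < M → s (+ t) ≡ σ t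
  s-< = extendℤ-< M σ σ-periodic

  σ-even : ∀ t → alt t ≡ 1ℤ → σ t ≡ + (2 ℕ.+ 2 ℕ.* (t % r))
  σ-even t even = begin
    saw t + + suc r * alt t                 ≡⟨ cong (λ x → saw t + + suc r * x) even ⟩
    + 2 * + j + 1ℤ - + r + + suc r * 1ℤ     ≡⟨ value (+ 2 * + j) (+ r) ⟩
    + 2 + + 2 * + j                         ≡⟨ cong (_+_ (+ 2)) (ℤ.pos-* 2 j) ⟨
    + (2 ℕ.+ 2 ℕ.* j)                       ∎
    where
    open ≡-Reasoning
    j : ℕ
    j = t % r
    value : ∀ x r → x + 1ℤ - r + (1ℤ + r) * 1ℤ ≡ + 2 + x
    value = solve-∀

  σ-odd : ∀ t → alt t ≡ -1ℤ → σ t ≡ + (1 ℕ.+ 2 ℕ.* (t % r)) [mod p ]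
  σ-odd t odd = ≡-mod-intro (σ t) _ -1ℤ (begin
    saw t + + suc r * alt t                        ≡⟨ cong (λ x → saw t + + suc r * x) odd ⟩
    + 2 * + j + 1ℤ - + r + + suc r * -1ℤ           ≡⟨ value (+ 2 * + j) (+ r) ⟩
    (1ℤ + + 2 * + j) + -1ℤ * (1ℤ + (+ r + + r))    ≡⟨ cong (λ x → (1ℤ + x) + -1ℤ * + p) (ℤ.pos-* 2 j) ⟨
    + (1 ℕ.+ 2 ℕ.* j) + -1ℤ * + p                  ∎)
    where
    open ≡-Reasoning
    j : ℕ
    j = t % r
    value : ∀ x r → x + 1ℤ - r + (1ℤ + r) * -1ℤ ≡ (1ℤ + x) + -1ℤ * (1ℤ + (r + r))
    value = solve-∀

  even-residue-< : ∀ {j} → j < r → 2 ℕ.+ 2 ℕ.* j < p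
  even-residue-< {j} j<r = s≤s (subst (ℕ._≤ M) (double-suc j) (ℕ.+-mono-≤ j<r j<r))
    where
    double-suc : ∀ j → suc j ℕ.+ suc j ≡ 2 ℕ.+ 2 ℕ.* j
    double-suc = ℕ-Ring.solve-∀

  odd-residue-< : ∀ {j} → j < r → 1 ℕ.+ 2 ℕ.* j < p
  odd-residue-< j<r = ℕ.<-trans (ℕ.n<1+n _) (even-residue-< j<r)

  s-even : ∀ i → i < M → alt i ≡ 1ℤ → s (+ i) ≡ + (2 ℕ.+ 2 ℕ.* (i % r)) [mod p ]
  s-even i i<M even = ≡⇒≡-mod (trans (s-< i i<M) (σ-even i even))

  s-odd : ∀ i → i < M → alt i ≡ -1ℤ → s (+ i) ≡ + (1 ℕ.+ 2 ℕ.* (i % r)) [mod p ]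
  s-odd i i<M odd = subst (λ x → x ≡ + (1 ℕ.+ 2 ℕ.* (i % r)) [mod p ]) (sym (s-< i i<M)) (σ-odd i odd)

  s-nonzero : ∀ i → i < M → ¬ (s (+ i) ≡ 0ℤ [mod p ])
  s-nonzero i i<M with alt-cases i
  ... | inj₁ even = ≡-mod-nonzero (s (+ i)) (even-residue-< (m%n<n i r)) (s-even i i<M even)
  ... | inj₂ odd  = ≡-mod-nonzero (s (+ i)) (odd-residue-< (m%n<n i r)) (s-odd i i<M odd)

  opposite-signs : ∀ {j} → j < r →
    (Σ ℕ λ t → t < M × t % r ≡ j × alt t ≡ 1ℤ) × (Σ ℕ λ t → t < M × t % r ≡ j × alt t ≡ -1ℤ)
  opposite-signs {j} j<r = choose (alt-cases j)
    where
    j<M : j < M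
    j<M = ℕ.<-≤-trans j<r (ℕ.m≤m+n r r)
    j+r<M : j ℕ.+ r < M
    j+r<M = ℕ.+-monoˡ-< r j<r
    j+r%r : (j ℕ.+ r) % r ≡ j
    j+r%r = trans ([m+n]%n≡m%n j r) (m<n⇒m%n≡m j<r)
    choose : alt j ≡ 1ℤ ⊎ alt j ≡ -1ℤ →
      (Σ ℕ λ t → t < M × t % r ≡ j × alt t ≡ 1ℤ) × (Σ ℕ λ t → t < M × t % r ≡ j × alt t ≡ -1ℤ)
    choose (inj₁ even) = (j , j<M , m<n⇒m%n≡m j<r , even) , (j ℕ.+ r , j+r<M , j+r%r , trans (alt-+r j) (cong -_ even))
    choose (inj₂ odd)  = (j ℕ.+ r , j+r<M , j+r%r , trans (alt-+r j) (cong -_ odd)) , (j , j<M , m<n⇒m%n≡m j<r , odd)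

  half-< : ∀ {j} → 1 ℕ.+ 2 ℕ.* j < p → j < r
  half-< {j} 1+2j<p = ℕ.*-cancelˡ-< 2 j r (subst (2 ℕ.* j <_) (cong (r ℕ.+_) (sym (ℕ.+-identityʳ r))) (ℕ.s≤s⁻¹ 1+2j<p))

  s-hits : ∀ c → suc c < p → Σ ℕ λ t → t < M × (s (+ t) ≡ + suc c [mod p ])
  s-hits c c<p with even-or-odd c
  ... | j , inj₁ c≡2j with opposite-signs (half-< {j} (subst (λ x → suc x < p) c≡2j c<p))
  ...   | _ , (t , t<M , t%r≡j , odd) =
          t , t<M , subst (λ x → s (+ t) ≡ + suc x [mod p ]) (trans (cong (2 ℕ.*_) t%r≡j) (sym c≡2j)) (s-odd t t<M odd)
  s-hits c c<p | j , inj₂ c≡1+2j with opposite-signs (half-< {j} (ℕ.<-trans (ℕ.n<1+n _) (subst (λ x → suc x < p) c≡1+2j c<p)))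
  ...   | (t , t<M , t%r≡j , even) , _ =
          t , t<M , subst (λ x → s (+ t) ≡ + suc x [mod p ]) (trans (cong (λ y → 1 ℕ.+ 2 ℕ.* y) t%r≡j) (sym c≡1+2j)) (s-even t t<M even)

  s-surjective : ∀ a → ¬ (a ≡ 0ℤ [mod p ]) → Σ ℕ λ i → i < M × (s (+ i) ≡ a [mod p ])
  s-surjective a a≢0 = hit (a %ℕ p) (ℤ.n%ℕd<d a p) (≡-mod-intro a _ (a ℤ./ℕ p) (ℤ.a≡a%ℕn+[a/ℕn]*n a p))
    where
    hit : ∀ c → c < p → a ≡ + c [mod p ] → Σ ℕ λ i → i < M × (s (+ i) ≡ a [mod p ])
    hit zero    _   a≡0 = contradiction a≡0 a≢0
    hit (suc c) c<p a≡c with s-hits c c<p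
    ... | t , t<M , s≡c = t , t<M , ≡-mod-trans (s (+ t)) (+ suc c) a s≡c (≡-mod-sym a (+ suc c) a≡c)

  multiple-of-r : ∀ t → t % r ≡ 0 → 1 ≤ t → t < M → t ≡ r
  multiple-of-r t t%r≡0 1≤t t<M = from-quotient (t / r) (trans (m≡m%n+[m/n]*n t r) (cong (ℕ._+ (t / r) ℕ.* r) t%r≡0))
    where
    from-quotient : ∀ q → t ≡ q ℕ.* r → t ≡ r
    from-quotient zero          t≡0    = contradiction (subst (1 ≤_) t≡0 1≤t) λ ()
    from-quotient (suc zero)    t≡r    = trans t≡r (ℕ.+-identityʳ r)
    from-quotient (suc (suc q)) t≡qr = contradiction t<M (ℕ.≤⇒≯ (subst (M ≤_) (sym t≡qr) (ℕ.+-monoʳ-≤ r (ℕ.m≤m+n r (q ℕ.* r)))))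

  s-period-fixes-2 : ∀ t → IsPeriod p s t → s (+ t) ≡ + 2 [mod p ]
  s-period-fixes-2 t periodic = ≡-mod-trans (s (+ t)) (s (+ 0)) (+ 2) (periodic (+ 0)) (≡⇒≡-mod (σ-even 0 refl))

  s-no-shorter-period : ∀ t → 1 ≤ t → t < M → ¬ IsPeriod p s t
  s-no-shorter-period t 1≤t t<M periodic with alt-cases t
  ... | inj₁ even = contradiction (trans (sym even) (trans (cong alt t≡r) r-odd)) λ ()
    where
    residue≡2 : 2 ℕ.+ 2 ℕ.* (t % r) ≡ 2
    residue≡2 = ≡-mod-injective (even-residue-< (m%n<n t r)) (even-residue-< {0} (s≤s z≤n))
      (≡-mod-trans (+ (2 ℕ.+ 2 ℕ.* (t % r))) (s (+ t)) (+ 2) (≡-mod-sym (s (+ t)) _ (s-even t t<M even)) (s-period-fixes-2 t periodic))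
    t≡r : t ≡ r
    t≡r = multiple-of-r t (ℕ.*-cancelˡ-≡ (t % r) 0 2 (ℕ.+-cancelˡ-≡ 2 _ 0 residue≡2)) 1≤t t<M
  ... | inj₂ odd = contradiction (ℕ.m*n≡1⇒m≡1 2 (t % r) (ℕ.suc-injective residue≡2)) λ ()
    where
    residue≡2 : 1 ℕ.+ 2 ℕ.* (t % r) ≡ 2
    residue≡2 = ≡-mod-injective (odd-residue-< (m%n<n t r)) (even-residue-< {0} (s≤s z≤n))
      (≡-mod-trans (+ (1 ℕ.+ 2 ℕ.* (t % r))) (s (+ t)) (+ 2) (≡-mod-sym (s (+ t)) _ (s-odd t t<M odd)) (s-period-fixes-2 t periodic))

half-double : ∀ r → (r ℕ.+ r) / 2 ≡ r
half-double r = trans (cong (_/ 2) (double r)) (m*n/n≡m r 2)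
  where
  double : ∀ r → r ℕ.+ r ≡ r ℕ.* 2
  double = ℕ-Ring.solve-∀

≡3-mod-4⇒2r+1 : ∀ p → 7 ≤ p → p % 4 ≡ 3 → Σ ℕ λ k → p ≡ suc ((3 ℕ.+ (k ℕ.+ k)) ℕ.+ (3 ℕ.+ (k ℕ.+ k)))
≡3-mod-4⇒2r+1 p 7≤p p%4≡3 with p / 4 | trans (m≡m%n+[m/n]*n p 4) (cong (ℕ._+ (p / 4) ℕ.* 4) p%4≡3)
... | zero  | p≡3     = contradiction (ℕ.≤-trans 7≤p (ℕ.≤-reflexive p≡3)) λ { (s≤s (s≤s (s≤s ()))) }
... | suc k | p≡7+4k  = k , trans p≡7+4k (expand k)
  where
  expand : ∀ k → 3 ℕ.+ suc k ℕ.* 4 ≡ suc ((3 ℕ.+ (k ℕ.+ k)) ℕ.+ (3 ℕ.+ (k ℕ.+ k)))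
  expand = ℕ-Ring.solve-∀

mainTheorem5 : (p : ℕ) → Prime p → 7 ≤ p → p % 4 ≡ 3 →
    ((Φ : ℕ → Poly) → IsCyclotomicFamily Φ →
      Σ Poly λ g →
        ((fPoly ((p ∸ 1) / 2) *ₚ g) *ₚ (xMinusOne *ₚ Φ (p ∸ 1))) ≈ₚ xPowMinusOne (p ∸ 1) [mod p ])
    ×
    (Σ (ℤ → ℤ) λ s →
      IsFSeq p (fPoly ((p ∸ 1) / 2)) s ×
      IsLeastPeriod p s (p ∸ 1) ×
      ValuesAreUnits p s (p ∸ 1))
mainTheorem5 p _ 7≤p p%4≡3 with ≡3-mod-4⇒2r+1 p 7≤p p%4≡3
... | k , refl rewrite half-double (3 ℕ.+ (k ℕ.+ k)) =
      (λ Φ cyclotomic → map₂ (λ eq i → ≡⇒≡-mod (coeff-≡ eq i)) (fPoly-cofactor (k ℕ.+ k) (alt-odd⇒∤2 r-odd) Φ cyclotomic))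
    , (s , s-isFSeq , (s≤s z≤n , s-periodic , s-no-shorter-period) , (s-nonzero , s-surjective))
  where
  r-odd : alt (3 ℕ.+ (k ℕ.+ k)) ≡ -1ℤ
  r-odd = cong (λ x → -1ℤ * (-1ℤ * (-1ℤ * x))) (alt-double k)
  open Construction (2 ℕ.+ (k ℕ.+ k)) r-odd
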